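{- Let $a,b$ be positive integers. Every element of $Q^2_{a,b}$ is a sum of at most four squares of elements of $Q_{a,b}$ in each of the following two cases: (i) $a=n_1^2+n_2^2$ for some integers $n_1,n_2$ with $\gcd(n_1,n_2)=1$; or (ii) $a=n_1^2+n_2^2$ for some integers $n_1,n_2$ with $\gcd(n_1,n_2)=2$ and $n_1\equiv 0\pmod 4$, and $b\not\equiv 0\pmod 4$. (Here $n_1=0$ is allowed, in which case $\gcd(0,n_2)=|n_2|$, so $n_2\in\{\pm1,\pm2\}$.)
   Context: For positive integers $a,b$, let $Q_{a,b}=\{\alpha_0+\alpha_1\mathbf{i}+\alpha_2\mathbf{j}+\alpha_3\mathbf{k} : \alpha_0,\alpha_1,\alpha_2,\alpha_3\in\mathbb{Z}\}$ be the quaternion ring with $\mathbf{i}^2=-a$, $\mathbf{j}^2=-b$, $\mathbf{i}\mathbf{j}=-\mathbf{j}\mathbf{i}=\mathbf{k}$ (so $\mathbf{k}^2=-ab$). Let $Q_{a,b}^2$ denote the additive group generated by all squares $x^2$, $x\in Q_{a,b}$. -}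

module Defs where

open import Data.Nat using (ℕ) renaming (_*_ to _*ℕ_)
open import Data.Integer using (ℤ; +_; _+_; _*_; -_; _-_)
open import Data.Product using (∃; ∃-syntax; _×_; _,_)

-- Elements α₀ + α₁ i + α₂ j + α₃ k of Q_{a,b}, with integer coordinates.
record Quat : Set where
  constructor quat
  field
    c₀ c₁ c₂ c₃ : ℤ

open Quat public

module _ (a b : ℕ) where
  private
    A B : ℤ
    A = + a
    B = + b

  -- Multiplication in Q_{a,b}: i² = -a, j² = -b, ij = -ji = k (so k² = -ab,
  -- jk = b i, kj = -b i, ki = a j, ik = -a j).
  mulQ : Quat → Quat → Quat
  mulQ (quat x₀ x₁ x₂ x₃) (quat y₀ y₁ y₂ y₃) = quat
    (x₀ * y₀ - A * (x₁ * y₁) - B * (x₂ * y₂) - (A * B) * (x₃ * y₃))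
    (x₀ * y₁ + x₁ * y₀ + B * (x₂ * y₃ - x₃ * y₂))
    (x₀ * y₂ + x₂ * y₀ + A * (x₃ * y₁ - x₁ * y₃))
    (x₀ * y₃ + x₃ * y₀ + x₁ * y₂ - x₂ * y₁)

  sqQ : Quat → Quat
  sqQ x = mulQ x x

addQ : Quat → Quat → Quat
addQ (quat x₀ x₁ x₂ x₃) (quat y₀ y₁ y₂ y₃) = quat (x₀ + y₀) (x₁ + y₁) (x₂ + y₂) (x₃ + y₃)

negQ : Quat → Quat
negQ (quat x₀ x₁ x₂ x₃) = quat (- x₀) (- x₁) (- x₂) (- x₃)

zeroQ : Quat
zeroQ = quat (+ 0) (+ 0) (+ 0) (+ 0)

data InQ² (a b : ℕ) : Quat → Set where
  zero∈ : InQ² a b zeroQ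
  sq∈   : ∀ x → InQ² a b (sqQ a b x)
  add∈  : ∀ {x y} → InQ² a b x → InQ² a b y → InQ² a b (addQ x y)
  neg∈  : ∀ {x} → InQ² a b x → InQ² a b (negQ x)

-- x is a sum of at most four squares (fewer squares = padding with 0²).
SumOfFourSquares : ℕ → ℕ → Quat → Set
SumOfFourSquares a b x =
  ∃[ y₁ ] ∃[ y₂ ] ∃[ y₃ ] ∃[ y₄ ]
    x ≡ addQ (addQ (addQ (sqQ a b y₁) (sqQ a b y₂)) (sqQ a b y₃)) (sqQ a b y₄)
  where open import Relation.Binary.PropositionalEquality using (_≡_)

{-# OPTIONS --safe #-}
module Submission where

-- A square in Q_{a,b} is (x₀ + x)² = x₀² − a x₁² − b x₂² − ab x₃² + 2x₀x, so Q²_{a,b} lies among the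
-- quaternions t + 2P i + 2Q j + 2R k, and it suffices to write each of these as a sum of four squares.
-- A fourth square 1 + c i + Q j + R k takes care of the j- and k-parts.  What remains is to write
-- T + 2P i as a sum of three squares of Z[√−a], and these are written down explicitly from a Bézout
-- relation n₁p + n₂q = 1 attached to a = n₁² + n₂² (to a = 4(N₁² + N₂²) in case (ii)); for instance
--   (r − ah + g i)² + (p + n₁g + (n₁h − rp) i)² + (q + n₂g + (n₂h − rq) i)²
--     = r² + (p² + q²)(1 − ar²) + 2g + 2(h − r(p² + q²)) i.
-- The free parameters reach every T up to a residue mod 2 (mod 4 in case (ii)); the residue is
-- adjusted by the choice of r, of the Bézout pair, and in case (ii) by a j-term in the first square,
-- which shifts T by −b and is where 4 ∤ b is needed.

open import Defs
open import Data.Nat using (ℕ; NonZero; suc; s≤s)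
import Data.Nat as ℕ
import Data.Nat.Properties as ℕ
open import Data.Nat.Divisibility using (1∣_)
open import Data.Nat.GCD using (gcd; gcd-GCD; gcd[m,n]∣n; module Bézout)
open import Data.Integer using (ℤ; +_; _+_; _*_; -_; _-_; ∣_∣; 0ℤ; 1ℤ; -1ℤ)
open import Data.Integer.Properties
  using (+-comm; +-identityˡ; +-identityʳ; *-comm; *-identityˡ; *-zeroʳ; -1*i≡-i; *-distribˡ-+;
         neg-distribʳ-*; pos-+; pos-*; abs-*; *-cancelˡ-≡; +∣i∣≡i⊎+∣i∣≡-i)
open import Data.Integer.DivMod using (_%ℕ_; _/ℕ_; a≡a%ℕn+[a/ℕn]*n; n%ℕd<d)
open import Data.Integer.Divisibility using (_∣_; *-monoʳ-∣)
open import Data.Integer.Divisibility.Signed using (divides; ∣ᵤ⇒∣)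
open import Data.Integer.Tactic.RingSolver using (solve-∀)
open import Data.Product using (∃; ∃-syntax; _×_; _,_; proj₁; proj₂)
open import Data.Sum using (_⊎_; inj₁; inj₂)
open import Data.Empty using (⊥; ⊥-elim)
open import Relation.Binary.PropositionalEquality
  using (_≡_; refl; sym; trans; cong; cong₂; subst; subst₂; module ≡-Reasoning)
open import Relation.Nullary using (¬_)

-- Identities with side conditions d ≡ e are proved by the ring solver in the form
-- x ≡ y + (d − e) * c, one such term per side condition.
≡-mod : ∀ {x y d e : ℤ} (c : ℤ) → d ≡ e → x ≡ y + (d - e) * c → x ≡ y
≡-mod {y = y} {d} c refl x≡ = trans x≡ (drop-zero-multiple y d c)
  where
  drop-zero-multiple : ∀ y d c → y + (d - d) * c ≡ y
  drop-zero-multiple = solve-∀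

2*k≢1 : ∀ k → + 2 * k ≡ 1ℤ → ⊥
2*k≢1 k eq with ℕ.m*n≡1⇒m≡1 2 ∣ k ∣ (trans (sym (abs-* (+ 2) k)) (cong ∣_∣ eq))
... | ()

division : ∀ x n .{{_ : NonZero n}} → x ≡ + n * (x /ℕ n) + + (x %ℕ n)
division x n = trans (a≡a%ℕn+[a/ℕn]*n x n)
  (trans (+-comm (+ (x %ℕ n)) (x /ℕ n * + n)) (cong (_+ + (x %ℕ n)) (*-comm (x /ℕ n) (+ n))))

data Parity (x : ℤ) : Set where
  even : ∀ k → x ≡ + 2 * k → Parity x
  odd  : ∀ k → x ≡ + 2 * k + 1ℤ → Parity x

parity : ∀ x → Parity x
parity x with x %ℕ 2 | division x 2 | n%ℕd<d x 2
... | 0 | eq | _ = even (x /ℕ 2) (trans eq (+-identityʳ _))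
... | 1 | eq | _ = odd (x /ℕ 2) eq
... | suc (suc _) | _ | s≤s (s≤s ())

data Mod4 (x : ℤ) : Set where
  4k   : ∀ k → x ≡ + 4 * k → Mod4 x
  4k+1 : ∀ k → x ≡ + 4 * k + 1ℤ → Mod4 x
  4k+2 : ∀ k → x ≡ + 4 * k + + 2 → Mod4 x
  4k+3 : ∀ k → x ≡ + 4 * k + + 3 → Mod4 x

mod4 : ∀ x → Mod4 x
mod4 x with x %ℕ 4 | division x 4 | n%ℕd<d x 4
... | 0 | eq | _ = 4k (x /ℕ 4) (trans eq (+-identityʳ _))
... | 1 | eq | _ = 4k+1 (x /ℕ 4) eq
... | 2 | eq | _ = 4k+2 (x /ℕ 4) eq
... | 3 | eq | _ = 4k+3 (x /ℕ 4) eq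
... | suc (suc (suc (suc _))) | _ | s≤s (s≤s (s≤s (s≤s ())))

sign-factor : ∀ n → ∃[ σ ] + ∣ n ∣ ≡ σ * n
sign-factor n with +∣i∣≡i⊎+∣i∣≡-i n
... | inj₁ eq = 1ℤ , trans eq (sym (*-identityˡ n))
... | inj₂ eq = -1ℤ , trans eq (sym (-1*i≡-i n))

signed-combination : ∀ n₁ n₂ σ₁ σ₂ X Y D →
  X * (σ₁ * n₁) ≡ D + Y * (σ₂ * n₂) → n₁ * (X * σ₁) + n₂ * - (Y * σ₂) ≡ D
signed-combination n₁ n₂ σ₁ σ₂ X Y D eq = ≡-mod 1ℤ eq (identity n₁ n₂ σ₁ σ₂ X Y D)
  where
  identity : ∀ n₁ n₂ σ₁ σ₂ X Y D →
    n₁ * (X * σ₁) + n₂ * - (Y * σ₂) ≡ D + (X * (σ₁ * n₁) - (D + Y * (σ₂ * n₂))) * 1ℤ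
  identity = solve-∀

pos-bézout : ∀ d x y m n → d ℕ.+ y ℕ.* n ≡ x ℕ.* m → + x * + m ≡ + d + + y * + n
pos-bézout d x y m n eq = trans (sym (pos-* x m))
  (trans (cong +_ (sym eq)) (trans (pos-+ d (y ℕ.* n)) (cong (λ z → + d + z) (pos-* y n))))

bézout-ℤ : ∀ n₁ n₂ → ∃[ p ] ∃[ q ] n₁ * p + n₂ * q ≡ + gcd ∣ n₁ ∣ ∣ n₂ ∣
bézout-ℤ n₁ n₂ with sign-factor n₁ | sign-factor n₂ | Bézout.identity (gcd-GCD ∣ n₁ ∣ ∣ n₂ ∣)
... | σ₁ , e₁ | σ₂ , e₂ | Bézout.+- x y eq = + x * σ₁ , - (+ y * σ₂) ,
  signed-combination n₁ n₂ σ₁ σ₂ (+ x) (+ y) d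
    (subst₂ (λ M N → + x * M ≡ d + + y * N) e₁ e₂ (pos-bézout (gcd ∣ n₁ ∣ ∣ n₂ ∣) x y ∣ n₁ ∣ ∣ n₂ ∣ eq))
  where d = + gcd ∣ n₁ ∣ ∣ n₂ ∣
... | σ₁ , e₁ | σ₂ , e₂ | Bézout.-+ x y eq = - (+ x * σ₁) , + y * σ₂ ,
  trans (+-comm (n₁ * - (+ x * σ₁)) (n₂ * (+ y * σ₂)))
    (signed-combination n₂ n₁ σ₂ σ₁ (+ y) (+ x) d
      (subst₂ (λ M N → + y * N ≡ d + + x * M) e₁ e₂ (pos-bézout (gcd ∣ n₁ ∣ ∣ n₂ ∣) y x ∣ n₂ ∣ ∣ n₁ ∣ eq)))
  where d = + gcd ∣ n₁ ∣ ∣ n₂ ∣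

shifted-bézout : ∀ n₁ n₂ p q → n₁ * p + n₂ * q ≡ 1ℤ → n₁ * (p + n₂) + n₂ * (q - n₁) ≡ 1ℤ
shifted-bézout n₁ n₂ p q bz = trans (shift n₁ n₂ p q) bz
  where
  shift : ∀ n₁ n₂ p q → n₁ * (p + n₂) + n₂ * (q - n₁) ≡ n₁ * p + n₂ * q
  shift = solve-∀

squareRe : ℤ → ℤ → Quat → ℤ
squareRe A B (quat x₀ x₁ x₂ x₃) = x₀ * x₀ - A * (x₁ * x₁) - B * (x₂ * x₂) - A * B * (x₃ * x₃)

cong-quat : ∀ {x₀ x₁ x₂ x₃ y₀ y₁ y₂ y₃} → x₀ ≡ y₀ → x₁ ≡ y₁ → x₂ ≡ y₂ → x₃ ≡ y₃ →
  quat x₀ x₁ x₂ x₃ ≡ quat y₀ y₁ y₂ y₃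
cong-quat refl refl refl refl = refl

sqQ-coordinates : ∀ a b x → sqQ a b x ≡
  quat (squareRe (+ a) (+ b) x) (+ 2 * (c₀ x * c₁ x)) (+ 2 * (c₀ x * c₂ x)) (+ 2 * (c₀ x * c₃ x))
sqQ-coordinates a b (quat x₀ x₁ x₂ x₃) = cong-quat refl
  (symmetrised-product (+ b) x₀ x₁ x₂ x₃)
  (symmetrised-product (+ a) x₀ x₂ x₃ x₁)
  (commutator-free x₀ x₁ x₂ x₃)
  where
  symmetrised-product : ∀ c x y z w → x * y + y * x + c * (z * w - w * z) ≡ + 2 * (x * y)
  symmetrised-product = solve-∀
  commutator-free : ∀ x₀ x₁ x₂ x₃ → x₀ * x₃ + x₃ * x₀ + x₁ * x₂ - x₂ * x₁ ≡ + 2 * (x₀ * x₃)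
  commutator-free = solve-∀

evenQuat : ℤ → ℤ → ℤ → ℤ → Quat
evenQuat t P Q R = quat t (+ 2 * P) (+ 2 * Q) (+ 2 * R)

InQ²⇒evenQuat : ∀ {a b x} → InQ² a b x → ∃[ t ] ∃[ P ] ∃[ Q ] ∃[ R ] x ≡ evenQuat t P Q R
InQ²⇒evenQuat zero∈ = 0ℤ , 0ℤ , 0ℤ , 0ℤ , refl
InQ²⇒evenQuat {a} {b} (sq∈ x) = _ , _ , _ , _ , sqQ-coordinates a b x
InQ²⇒evenQuat (add∈ x∈ y∈) with InQ²⇒evenQuat x∈ | InQ²⇒evenQuat y∈
... | t , P , Q , R , refl | t′ , P′ , Q′ , R′ , refl = t + t′ , P + P′ , Q + Q′ , R + R′ ,
  cong-quat refl (sym (*-distribˡ-+ (+ 2) P P′)) (sym (*-distribˡ-+ (+ 2) Q Q′))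
                 (sym (*-distribˡ-+ (+ 2) R R′))
InQ²⇒evenQuat (neg∈ x∈) with InQ²⇒evenQuat x∈
... | t , P , Q , R , refl = - t , - P , - Q , - R ,
  cong-quat refl (neg-distribʳ-* (+ 2) P) (neg-distribʳ-* (+ 2) Q) (neg-distribʳ-* (+ 2) R)

-- y₁² + y₂² + y₃² + y₄² = evenQuat t P Q R in Q_{A,B}, read off coordinatewise.
record FourSquares (A B t P Q R : ℤ) : Set where
  constructor fourSquares
  field
    y₁ y₂ y₃ y₄ : Quat
    re-sum : squareRe A B y₁ + squareRe A B y₂ + squareRe A B y₃ + squareRe A B y₄ ≡ t
    i-sum  : c₀ y₁ * c₁ y₁ + c₀ y₂ * c₁ y₂ + c₀ y₃ * c₁ y₃ + c₀ y₄ * c₁ y₄ ≡ P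
    j-sum  : c₀ y₁ * c₂ y₁ + c₀ y₂ * c₂ y₂ + c₀ y₃ * c₂ y₃ + c₀ y₄ * c₂ y₄ ≡ Q
    k-sum  : c₀ y₁ * c₃ y₁ + c₀ y₂ * c₃ y₂ + c₀ y₃ * c₃ y₃ + c₀ y₄ * c₃ y₄ ≡ R

subst-FourSquares : ∀ {A B t t′ P P′ Q R} →
  FourSquares A B t P Q R → t ≡ t′ → P ≡ P′ → FourSquares A B t′ P′ Q R
subst-FourSquares ys refl refl = ys

FourSquares⇒SumOfFourSquares : ∀ {a b t P Q R} →
  FourSquares (+ a) (+ b) t P Q R → SumOfFourSquares a b (evenQuat t P Q R)
FourSquares⇒SumOfFourSquares {a} {b} (fourSquares y₁ y₂ y₃ y₄ refl refl refl refl) =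
  y₁ , y₂ , y₃ , y₄ , sym (trans
    (cong₂ addQ (cong₂ addQ (cong₂ addQ (sqQ-coordinates a b y₁) (sqQ-coordinates a b y₂))
                            (sqQ-coordinates a b y₃))
                (sqQ-coordinates a b y₄))
    (cong-quat refl (doubled c₁) (doubled c₂) (doubled c₃)))
  where
  sum-of-doubles : ∀ x₁ x₂ x₃ x₄ → + 2 * x₁ + + 2 * x₂ + + 2 * x₃ + + 2 * x₄ ≡ + 2 * (x₁ + x₂ + x₃ + x₄)
  sum-of-doubles = solve-∀
  doubled : ∀ (f : Quat → ℤ) →
    + 2 * (c₀ y₁ * f y₁) + + 2 * (c₀ y₂ * f y₂) + + 2 * (c₀ y₃ * f y₃) + + 2 * (c₀ y₄ * f y₄)
    ≡ + 2 * (c₀ y₁ * f y₁ + c₀ y₂ * f y₂ + c₀ y₃ * f y₃ + c₀ y₄ * f y₄)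
  doubled f = sum-of-doubles (c₀ y₁ * f y₁) (c₀ y₂ * f y₂) (c₀ y₃ * f y₃) (c₀ y₄ * f y₄)

InQ²⇒SumOfFourSquares : ∀ {a b x} → InQ² a b x → (∀ t P Q R → FourSquares (+ a) (+ b) t P Q R) →
  SumOfFourSquares a b x
InQ²⇒SumOfFourSquares {a} {b} x∈ fourSquares-everywhere with InQ²⇒evenQuat x∈
... | t , P , Q , R , x≡ = subst (SumOfFourSquares a b) (sym x≡)
  (FourSquares⇒SumOfFourSquares (fourSquares-everywhere t P Q R))

-- (u₁ + v₁ i)² + (u₂ + v₂ i)² + (u₃ + v₃ i)² = T + 2P i, where i² = −A.
record PlaneSquares (A T P : ℤ) : Set where
  constructor planeSquares
  field
    u₁ v₁ u₂ v₂ u₃ v₃ : ℤ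
    norm-sum : u₁ * u₁ - A * (v₁ * v₁) + (u₂ * u₂ - A * (v₂ * v₂)) + (u₃ * u₃ - A * (v₃ * v₃)) ≡ T
    dot-sum  : u₁ * v₁ + u₂ * v₂ + u₃ * v₃ ≡ P

open PlaneSquares using (u₁)

subst-PlaneSquares : ∀ {A T T′ P P′} → PlaneSquares A T P → T ≡ T′ → P ≡ P′ → PlaneSquares A T′ P′
subst-PlaneSquares us refl refl = us

fromPlane : ∀ {A B T P} (ρ : PlaneSquares A T P) (pp w Q′ Q R : ℤ) → u₁ ρ * w + Q′ ≡ Q →
  FourSquares A B (T - B * (w * w) + (1ℤ - A * (pp * pp) - B * (Q′ * Q′) - A * B * (R * R))) (P + pp) Q R
fromPlane {A} {B} (planeSquares u₁ v₁ u₂ v₂ u₃ v₃ refl refl) pp w Q′ Q R refl =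
  fourSquares (quat u₁ v₁ w 0ℤ) (quat u₂ v₂ 0ℤ 0ℤ) (quat u₃ v₃ 0ℤ 0ℤ) (quat 1ℤ pp Q′ R)
    (trans (cong₂ _+_ (cong₂ _+_ (cong₂ _+_ (no-k A B u₁ v₁ w) (no-k A B u₂ v₂ 0ℤ))
                                 (no-k A B u₃ v₃ 0ℤ)) refl)
           (regroup (u₁ * u₁ - A * (v₁ * v₁)) (u₂ * u₂ - A * (v₂ * v₂)) (u₃ * u₃ - A * (v₃ * v₃)) B w
                    (1ℤ - A * (pp * pp) - B * (Q′ * Q′) - A * B * (R * R))))
    (cong (λ x → u₁ * v₁ + u₂ * v₂ + u₃ * v₃ + x) (*-identityˡ pp))
    (j-sum (u₁ * w) u₂ u₃ Q′)
    (k-sum u₁ u₂ u₃ R)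
  where
  no-k : ∀ A B u v w →
    u * u - A * (v * v) - B * (w * w) - A * B * (0ℤ * 0ℤ) ≡ u * u - A * (v * v) - B * (w * w)
  no-k = solve-∀
  regroup : ∀ x₁ x₂ x₃ B w K →
    x₁ - B * (w * w) + (x₂ - B * (0ℤ * 0ℤ)) + (x₃ - B * (0ℤ * 0ℤ)) + K ≡ x₁ + x₂ + x₃ - B * (w * w) + K
  regroup = solve-∀
  j-sum : ∀ x y z Q′ → x + y * 0ℤ + z * 0ℤ + 1ℤ * Q′ ≡ x + Q′
  j-sum = solve-∀
  k-sum : ∀ x y z R → x * 0ℤ + y * 0ℤ + z * 0ℤ + 1ℤ * R ≡ R
  k-sum = solve-∀

-- Case (i): a = n₁² + n₂² with n₁ p + n₂ q = 1

planeFamilyI : ∀ {A} n₁ n₂ p q {S} → A ≡ n₁ * n₁ + n₂ * n₂ → n₁ * p + n₂ * q ≡ 1ℤ → p * p + q * q ≡ S →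
  ∀ r g h → PlaneSquares A (r * r + S * (1ℤ - A * (r * r)) + + 2 * g) (h - r * S)
planeFamilyI {A} n₁ n₂ p q {S} A≡ bz S≡ r g h =
  planeSquares (r - A * h) g (p + n₁ * g) (n₁ * h - r * p) (q + n₂ * g) (n₂ * h - r * q)
    (≡-mod _ S≡ (≡-mod _ bz (≡-mod _ (sym A≡) (norm-identity A n₁ n₂ p q S r g h))))
    (≡-mod _ S≡ (≡-mod _ bz (≡-mod _ (sym A≡) (dot-identity A n₁ n₂ p q S r g h))))
  where
  norm-identity : ∀ A n₁ n₂ p q S r g h →
    (r - A * h) * (r - A * h) - A * (g * g)
      + ((p + n₁ * g) * (p + n₁ * g) - A * ((n₁ * h - r * p) * (n₁ * h - r * p)))
      + ((q + n₂ * g) * (q + n₂ * g) - A * ((n₂ * h - r * q) * (n₂ * h - r * q)))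
    ≡ r * r + S * (1ℤ - A * (r * r)) + + 2 * g
      + (p * p + q * q - S) * (1ℤ - A * (r * r))
      + (n₁ * p + n₂ * q - 1ℤ) * (+ 2 * g + + 2 * A * r * h)
      + (n₁ * n₁ + n₂ * n₂ - A) * (g * g - A * (h * h))
  norm-identity = solve-∀
  dot-identity : ∀ A n₁ n₂ p q S r g h →
    (r - A * h) * g + (p + n₁ * g) * (n₁ * h - r * p) + (q + n₂ * g) * (n₂ * h - r * q)
    ≡ h - r * S + (p * p + q * q - S) * (- r) + (n₁ * p + n₂ * q - 1ℤ) * (h - r * g)
      + (n₁ * n₁ + n₂ * n₂ - A) * (g * h)
  dot-identity = solve-∀

module _ {A : ℤ} (n₁ n₂ p q : ℤ) (A≡ : A ≡ n₁ * n₁ + n₂ * n₂) (bz : n₁ * p + n₂ * q ≡ 1ℤ) where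

  private
    r≡0 : ∀ A S k T → 0ℤ * 0ℤ + S * (1ℤ - A * (0ℤ * 0ℤ)) + + 2 * k ≡ T + (+ 2 * k - (T - S)) * 1ℤ
    r≡0 = solve-∀

    r≡0-shifted : ∀ A S c k α T →
      0ℤ * 0ℤ + (S + + 2 * c + A) * (1ℤ - A * (0ℤ * 0ℤ)) + + 2 * (k - c - α)
      ≡ T + (A - (+ 2 * α + 1ℤ)) * 1ℤ + (+ 2 * k + 1ℤ - (T - S)) * 1ℤ
    r≡0-shifted = solve-∀

    r≡1 : ∀ A S k α T →
      1ℤ * 1ℤ + S * (1ℤ - A * (1ℤ * 1ℤ)) + + 2 * (k + α * S)
      ≡ T + (A - + 2 * α) * (- S) + (+ 2 * k + 1ℤ - (T - S)) * 1ℤ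
    r≡1 = solve-∀

    shifted-norm : (p + n₂) * (p + n₂) + (q - n₁) * (q - n₁) ≡ p * p + q * q + + 2 * (p * n₂ - q * n₁) + A
    shifted-norm = ≡-mod 1ℤ (sym A≡) (identity A n₁ n₂ p q)
      where
      identity : ∀ A n₁ n₂ p q → (p + n₂) * (p + n₂) + (q - n₁) * (q - n₁)
        ≡ p * p + q * q + + 2 * (p * n₂ - q * n₁) + A + (n₁ * n₁ + n₂ * n₂ - A) * 1ℤ
      identity = solve-∀

    minus-0* : ∀ P S → P - 0ℤ * S ≡ P
    minus-0* = solve-∀

    plus-minus-1* : ∀ P S → P + S - 1ℤ * S ≡ P
    plus-minus-1* = solve-∀

  -- When T − (p² + q²) is odd, an odd A changes the parity of p² + q² through the shifted Bézout
  -- pair (p + n₂, q − n₁), and an even A allows r = 1.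
  planeSquaresI : ∀ T P → PlaneSquares A T P
  planeSquaresI T P with parity (T - (p * p + q * q))
  ... | even k eq = subst-PlaneSquares (planeFamilyI n₁ n₂ p q A≡ bz refl 0ℤ k P)
    (≡-mod 1ℤ (sym eq) (r≡0 A (p * p + q * q) k T))
    (minus-0* P (p * p + q * q))
  ... | odd k eq with parity A
  ...   | odd α A≡2α+1 = subst-PlaneSquares
    (planeFamilyI n₁ n₂ (p + n₂) (q - n₁) A≡ (shifted-bézout n₁ n₂ p q bz) shifted-norm
                  0ℤ (k - (p * n₂ - q * n₁) - α) P)
    (≡-mod 1ℤ A≡2α+1 (≡-mod 1ℤ (sym eq) (r≡0-shifted A (p * p + q * q) (p * n₂ - q * n₁) k α T)))
    (minus-0* P (p * p + q * q + + 2 * (p * n₂ - q * n₁) + A))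
  ...   | even α A≡2α = subst-PlaneSquares
    (planeFamilyI n₁ n₂ p q A≡ bz refl 1ℤ (k + α * (p * p + q * q)) (P + (p * p + q * q)))
    (≡-mod (- (p * p + q * q)) A≡2α (≡-mod 1ℤ (sym eq) (r≡1 A (p * p + q * q) k α T)))
    (plus-minus-1* P (p * p + q * q))

  fourSquaresI : ∀ B t P Q R → FourSquares A B t P Q R
  fourSquaresI B t P Q R = subst-FourSquares
    (fromPlane ρ 0ℤ 0ℤ Q Q R (trans (cong (_+ Q) (*-zeroʳ (u₁ ρ))) (+-identityˡ Q)))
    (target A B t Q R)
    (+-identityʳ P)
    where
    ρ : PlaneSquares A (t - (1ℤ - B * (Q * Q) - A * B * (R * R))) P
    ρ = planeSquaresI (t - (1ℤ - B * (Q * Q) - A * B * (R * R))) P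
    target : ∀ A B t Q R → t - (1ℤ - B * (Q * Q) - A * B * (R * R)) - B * (0ℤ * 0ℤ)
      + (1ℤ - A * (0ℤ * 0ℤ) - B * (Q * Q) - A * B * (R * R)) ≡ t
    target = solve-∀

fourSquares-gcd1 : ∀ {A} n₁ n₂ → A ≡ n₁ * n₁ + n₂ * n₂ → gcd ∣ n₁ ∣ ∣ n₂ ∣ ≡ 1 →
  ∀ B t P Q R → FourSquares A B t P Q R
fourSquares-gcd1 n₁ n₂ A≡ g≡1 with bézout-ℤ n₁ n₂
... | p , q , bz = fourSquaresI n₁ n₂ p q A≡ (trans bz (cong +_ g≡1))

-- Case (ii): a = 4(N₁² + N₂²) with N₁ even, N₂ odd and N₁ p + N₂ q = 1

normSq : ℤ → ℤ → ℤ
normSq p q = p * p + q * q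

record BézoutPair (N₁ N₂ c : ℤ) : Set where
  constructor bézoutPair
  field
    p q σ : ℤ
    bézout : N₁ * p + N₂ * q ≡ 1ℤ
    norm≡ : p * p + q * q ≡ c + + 4 * σ

planeFamilyII : ∀ {A′} N₁ N₂ p q {S} → A′ ≡ N₁ * N₁ + N₂ * N₂ → N₁ * p + N₂ * q ≡ 1ℤ → p * p + q * q ≡ S →
  ∀ s g h → PlaneSquares (+ 4 * A′) (s * s * S + + 4 * s * g) (s * h)
planeFamilyII {A′} N₁ N₂ p q {S} A′≡ bz S≡ s g h =
  planeSquares (- (+ 2 * A′ * h)) g (s * p + + 2 * g * N₁) (h * N₁) (s * q + + 2 * g * N₂) (h * N₂)
    (≡-mod _ S≡ (≡-mod _ bz (≡-mod _ (sym A′≡) (norm-identity A′ N₁ N₂ p q S s g h))))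
    (≡-mod _ bz (≡-mod _ (sym A′≡) (dot-identity A′ N₁ N₂ p q s g h)))
  where
  norm-identity : ∀ A′ N₁ N₂ p q S s g h →
    - (+ 2 * A′ * h) * - (+ 2 * A′ * h) - + 4 * A′ * (g * g)
      + ((s * p + + 2 * g * N₁) * (s * p + + 2 * g * N₁) - + 4 * A′ * (h * N₁ * (h * N₁)))
      + ((s * q + + 2 * g * N₂) * (s * q + + 2 * g * N₂) - + 4 * A′ * (h * N₂ * (h * N₂)))
    ≡ s * s * S + + 4 * s * g
      + (p * p + q * q - S) * (s * s)
      + (N₁ * p + N₂ * q - 1ℤ) * (+ 4 * s * g)
      + (N₁ * N₁ + N₂ * N₂ - A′) * (+ 4 * g * g - + 4 * A′ * h * h)
  norm-identity = solve-∀
  dot-identity : ∀ A′ N₁ N₂ p q s g h →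
    - (+ 2 * A′ * h) * g + (s * p + + 2 * g * N₁) * (h * N₁) + (s * q + + 2 * g * N₂) * (h * N₂)
    ≡ s * h + (N₁ * p + N₂ * q - 1ℤ) * (s * h) + (N₁ * N₁ + N₂ * N₂ - A′) * (+ 2 * g * h)
  dot-identity = solve-∀

planeFamilyII-coupling : ∀ A′ h w Q → - (+ 2 * A′ * h) * w + (Q + + 2 * A′ * h * w) ≡ Q
planeFamilyII-coupling = solve-∀

module _ {A′ N₁ N₂ : ℤ} (A′≡ : A′ ≡ N₁ * N₁ + N₂ * N₂)
         (pair₁ : BézoutPair N₁ N₂ 1ℤ) (pair₂ : BézoutPair N₁ N₂ (+ 2)) (B Q R : ℤ) where

  private
    K₀ : ℤ
    K₀ = 1ℤ - B * (Q * Q) - + 4 * A′ * B * (R * R)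

    scale₁-identity : ∀ A′ B Q R P w k c σ t →
      1ℤ * 1ℤ * (c + + 4 * σ) + + 4 * 1ℤ * (k - σ + B * A′ * P * w * (Q + A′ * P * w)) - B * (w * w)
        + (1ℤ - + 4 * A′ * (0ℤ * 0ℤ) - B * ((Q + + 2 * A′ * P * w) * (Q + + 2 * A′ * P * w))
           - + 4 * A′ * B * (R * R))
      ≡ t + (+ 4 * k + c - (t - (1ℤ - B * (Q * Q) - + 4 * A′ * B * (R * R)) + B * (w * w))) * 1ℤ
    scale₁-identity = solve-∀

    scale₂-identity : ∀ A′ B Q R h pp w e c σ x t →
      + 2 * + 2 * (c + + 4 * σ) + + 4 * + 2 * (x + 1ℤ - c - + 2 * σ) - B * (w * w)
        + (1ℤ - + 4 * A′ * (pp * pp) - B * ((Q + + 2 * A′ * h * w) * (Q + + 2 * A′ * h * w))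
           - + 4 * A′ * B * (R * R))
      ≡ t + (+ 4 * e - (t - (1ℤ - B * (Q * Q) - + 4 * A′ * B * (R * R)) + B * (w * w))) * 1ℤ
        + (e + A′ * (pp * pp) + B * A′ * h * w * (Q + A′ * h * w) - (+ 2 * x + (+ 2 - c))) * - + 4
    scale₂-identity = solve-∀

  scale₁ : ∀ {c} → BézoutPair N₁ N₂ c → ∀ {t} P w k → t - K₀ + B * (w * w) ≡ + 4 * k + c →
    FourSquares (+ 4 * A′) B t P Q R
  scale₁ {c} (bézoutPair p q σ bz norm≡) {t} P w k eq = subst-FourSquares
    (fromPlane (planeFamilyII N₁ N₂ p q A′≡ bz norm≡ 1ℤ (k - σ + B * A′ * P * w * (Q + A′ * P * w)) P)
               0ℤ w (Q + + 2 * A′ * P * w) Q R (planeFamilyII-coupling A′ P w Q))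
    (≡-mod 1ℤ (sym eq) (scale₁-identity A′ B Q R P w k c σ t))
    (trans (+-identityʳ (1ℤ * P)) (*-identityˡ P))

  scale₂-with-pair : ∀ {c} → BézoutPair N₁ N₂ c → ∀ {t} h pp w e x → t - K₀ + B * (w * w) ≡ + 4 * e →
    e + A′ * (pp * pp) + B * A′ * h * w * (Q + A′ * h * w) ≡ + 2 * x + (+ 2 - c) →
    FourSquares (+ 4 * A′) B t (+ 2 * h + pp) Q R
  scale₂-with-pair {c} (bézoutPair p q σ bz norm≡) {t} h pp w e x eq E≡ = subst-FourSquares
    (fromPlane (planeFamilyII N₁ N₂ p q A′≡ bz norm≡ (+ 2) (x + 1ℤ - c - + 2 * σ) h)
               pp w (Q + + 2 * A′ * h * w) Q R (planeFamilyII-coupling A′ h w Q))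
    (≡-mod 1ℤ (sym eq) (≡-mod (- + 4) E≡ (scale₂-identity A′ B Q R h pp w e c σ x t)))
    refl

  scale₂-with-pp : ∀ {t} h pp w e → t - K₀ + B * (w * w) ≡ + 4 * e →
    FourSquares (+ 4 * A′) B t (+ 2 * h + pp) Q R
  scale₂-with-pp h pp w e eq with parity (e + A′ * (pp * pp) + B * A′ * h * w * (Q + A′ * h * w))
  ... | odd x E≡ = scale₂-with-pair pair₁ h pp w e x eq E≡
  ... | even x E≡ = scale₂-with-pair pair₂ h pp w e x eq (trans E≡ (sym (+-identityʳ (+ 2 * x))))

  scale₂ : ∀ {t} P w e → t - K₀ + B * (w * w) ≡ + 4 * e → FourSquares (+ 4 * A′) B t P Q R
  scale₂ P w e eq with parity P
  ... | even h refl = subst-FourSquares (scale₂-with-pp h 0ℤ w e eq) refl (+-identityʳ (+ 2 * h))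
  ... | odd h refl = scale₂-with-pp h 1ℤ w e eq

  private
    residual : ∀ t {X Y} w → t - K₀ ≡ X → B ≡ Y → t - K₀ + B * (w * w) ≡ X + Y * (w * w)
    residual t w = cong₂ (λ x y → x + y * (w * w))

    plus-zero-multiple : ∀ X Y → X + Y * (0ℤ * 0ℤ) ≡ X
    plus-zero-multiple = solve-∀

    carry : ∀ e β r → + 4 * e + + 3 + (+ 4 * β + r) * (1ℤ * 1ℤ) ≡ + 4 * (e + β + 1ℤ) + (r - 1ℤ)
    carry = solve-∀

  -- Residues 1 and 2 mod 4 of t − K₀ come from s = 1, residue 0 from s = 2; residue 3 needs the
  -- j-term w = 1, which adds B ≢ 0 (mod 4).
  fourSquaresII : ¬ (+ 4 ∣ B) → ∀ t P → FourSquares (+ 4 * A′) B t P Q R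
  fourSquaresII 4∤B t P with mod4 (t - K₀)
  ... | 4k+1 k eq = scale₁ pair₁ P 0ℤ k (trans (residual t 0ℤ eq refl) (plus-zero-multiple _ B))
  ... | 4k+2 k eq = scale₁ pair₂ P 0ℤ k (trans (residual t 0ℤ eq refl) (plus-zero-multiple _ B))
  ... | 4k e eq = scale₂ P 0ℤ e (trans (residual t 0ℤ eq refl) (plus-zero-multiple _ B))
  fourSquaresII 4∤B t P | 4k+3 e eq with mod4 B
  ... | 4k β B≡ = ⊥-elim (4∤B (subst (+ 4 ∣_) (sym B≡) (*-monoʳ-∣ (+ 4) {1ℤ} {β} (1∣ ∣ β ∣))))
  ... | 4k+1 β B≡ = scale₂ P 1ℤ (e + β + 1ℤ)
    (trans (residual t 1ℤ eq B≡) (trans (carry e β 1ℤ) (+-identityʳ (+ 4 * (e + β + 1ℤ)))))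
  ... | 4k+2 β B≡ = scale₁ pair₁ P 1ℤ (e + β + 1ℤ) (trans (residual t 1ℤ eq B≡) (carry e β (+ 2)))
  ... | 4k+3 β B≡ = scale₁ pair₂ P 1ℤ (e + β + 1ℤ) (trans (residual t 1ℤ eq B≡) (carry e β (+ 3)))

odd-of-bézout : ∀ m k p q → + 2 * m * p + k * q ≡ 1ℤ → ∃[ n ] k ≡ + 2 * n + 1ℤ
odd-of-bézout m k p q bz with parity k
... | odd n k≡ = n , k≡
... | even n k≡ = ⊥-elim (2*k≢1 (m * p + n * q) (begin
  + 2 * (m * p + n * q)     ≡⟨ distrib m n p q ⟩
  + 2 * m * p + + 2 * n * q ≡⟨ cong (λ k → + 2 * m * p + k * q) (sym k≡) ⟩
  + 2 * m * p + k * q       ≡⟨ bz ⟩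
  1ℤ                        ∎))
  where
  open ≡-Reasoning
  distrib : ∀ m n p q → + 2 * (m * p + n * q) ≡ + 2 * m * p + + 2 * n * q
  distrib = solve-∀

norm-even-odd : ∀ x y →
  + 2 * x * (+ 2 * x) + (+ 2 * y + 1ℤ) * (+ 2 * y + 1ℤ) ≡ 1ℤ + + 4 * (x * x + y * y + y)
norm-even-odd = solve-∀

norm-odd-odd : ∀ x y →
  (+ 2 * x + 1ℤ) * (+ 2 * x + 1ℤ) + (+ 2 * y + 1ℤ) * (+ 2 * y + 1ℤ) ≡ + 2 + + 4 * (x * x + x + y * y + y)
norm-odd-odd = solve-∀

shifted-norm-even-odd : ∀ m n x y →
  (+ 2 * x + (+ 2 * n + 1ℤ)) * (+ 2 * x + (+ 2 * n + 1ℤ))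
    + (+ 2 * y + 1ℤ - + 2 * m) * (+ 2 * y + 1ℤ - + 2 * m)
  ≡ + 2 + + 4 * ((x + n) * (x + n + 1ℤ) + (y - m) * (y - m + 1ℤ))
shifted-norm-even-odd = solve-∀

shifted-norm-odd-odd : ∀ m n x y →
  (+ 2 * x + 1ℤ + (+ 2 * n + 1ℤ)) * (+ 2 * x + 1ℤ + (+ 2 * n + 1ℤ))
    + (+ 2 * y + 1ℤ - + 2 * m) * (+ 2 * y + 1ℤ - + 2 * m)
  ≡ 1ℤ + + 4 * ((x + n + 1ℤ) * (x + n + 1ℤ) + (y - m) * (y - m + 1ℤ))
shifted-norm-odd-odd = solve-∀

-- One of (p, q) and (p + N₂, q − N₁) has p even and norm ≡ 1 (mod 4), the other p odd and norm ≡ 2.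
bézoutPairs : ∀ m n p q → + 2 * m * p + (+ 2 * n + 1ℤ) * q ≡ 1ℤ →
  BézoutPair (+ 2 * m) (+ 2 * n + 1ℤ) 1ℤ × BézoutPair (+ 2 * m) (+ 2 * n + 1ℤ) (+ 2)
bézoutPairs m n p q bz
  with odd-of-bézout m q p (+ 2 * n + 1ℤ)
         (trans (cong (λ x → + 2 * m * p + x) (*-comm q (+ 2 * n + 1ℤ))) bz)
     | parity p
... | y , q≡ | even x p≡ =
  bézoutPair p q (x * x + y * y + y) bz (trans (cong₂ normSq p≡ q≡) (norm-even-odd x y)) ,
  bézoutPair (p + (+ 2 * n + 1ℤ)) (q - + 2 * m) ((x + n) * (x + n + 1ℤ) + (y - m) * (y - m + 1ℤ))
    (shifted-bézout (+ 2 * m) (+ 2 * n + 1ℤ) p q bz)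
    (trans (cong₂ normSq (cong (_+ (+ 2 * n + 1ℤ)) p≡) (cong (_- + 2 * m) q≡))
           (shifted-norm-even-odd m n x y))
... | y , q≡ | odd x p≡ =
  bézoutPair (p + (+ 2 * n + 1ℤ)) (q - + 2 * m) ((x + n + 1ℤ) * (x + n + 1ℤ) + (y - m) * (y - m + 1ℤ))
    (shifted-bézout (+ 2 * m) (+ 2 * n + 1ℤ) p q bz)
    (trans (cong₂ normSq (cong (_+ (+ 2 * n + 1ℤ)) p≡) (cong (_- + 2 * m) q≡))
           (shifted-norm-odd-odd m n x y)) ,
  bézoutPair p q (x * x + x + y * y + y) bz (trans (cong₂ normSq p≡ q≡) (norm-odd-odd x y))

halve-bézout : ∀ {n₁ n₂} m k p q → n₁ ≡ m * + 4 → n₂ ≡ k * + 2 → n₁ * p + n₂ * q ≡ + 2 →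
  + 2 * m * p + k * q ≡ 1ℤ
halve-bézout {n₁} {n₂} m k p q n₁≡ n₂≡ bz = *-cancelˡ-≡ (+ 2) _ _ (begin
  + 2 * (+ 2 * m * p + k * q)   ≡⟨ distrib m k p q ⟩
  m * + 4 * p + k * + 2 * q     ≡⟨ cong₂ (λ x y → x * p + y * q) (sym n₁≡) (sym n₂≡) ⟩
  n₁ * p + n₂ * q               ≡⟨ bz ⟩
  + 2                           ∎)
  where
  open ≡-Reasoning
  distrib : ∀ m k p q → + 2 * (+ 2 * m * p + k * q) ≡ m * + 4 * p + k * + 2 * q
  distrib = solve-∀

record EvenOddHalves (a : ℕ) : Set where
  constructor mkEvenOddHalves
  field
    m n p q : ℤ
    a≡ : + a ≡ + 4 * normSq (+ 2 * m) (+ 2 * n + 1ℤ)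
    bézout : + 2 * m * p + (+ 2 * n + 1ℤ) * q ≡ 1ℤ

evenOddHalves : ∀ {a} n₁ n₂ → + a ≡ n₁ * n₁ + n₂ * n₂ → gcd ∣ n₁ ∣ ∣ n₂ ∣ ≡ 2 → + 4 ∣ n₁ → EvenOddHalves a
evenOddHalves n₁ n₂ a≡ g≡2 4∣n₁
  with ∣ᵤ⇒∣ {+ 4} {n₁} 4∣n₁ | ∣ᵤ⇒∣ {+ 2} {n₂} (subst (λ d → + d ∣ n₂) g≡2 (gcd[m,n]∣n ∣ n₁ ∣ ∣ n₂ ∣))
     | bézout-ℤ n₁ n₂
... | divides m n₁≡ | divides k n₂≡ | p , q , bz with halve-bézout m k p q n₁≡ n₂≡ (trans bz (cong +_ g≡2))
... | bz′ with odd-of-bézout m k p q bz′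
... | n , k≡ = mkEvenOddHalves m n p q
  (trans a≡ (trans (cong₂ normSq n₁≡ (trans n₂≡ (cong (_* + 2) k≡))) (quadruple m n)))
  (trans (cong (λ k → + 2 * m * p + k * q) (sym k≡)) bz′)
  where
  quadruple : ∀ m n → m * + 4 * (m * + 4) + (+ 2 * n + 1ℤ) * + 2 * ((+ 2 * n + 1ℤ) * + 2)
                    ≡ + 4 * (+ 2 * m * (+ 2 * m) + (+ 2 * n + 1ℤ) * (+ 2 * n + 1ℤ))
  quadruple = solve-∀

fourSquares-gcd2 : ∀ {a b} → EvenOddHalves a → ¬ (+ 4 ∣ + b) → ∀ t P Q R → FourSquares (+ a) (+ b) t P Q R
fourSquares-gcd2 {b = b} (mkEvenOddHalves m n p q a≡ bz) 4∤b t P Q R =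
  subst (λ A → FourSquares A (+ b) t P Q R) (sym a≡)
    (fourSquaresII {normSq (+ 2 * m) (+ 2 * n + 1ℤ)} refl pair₁ pair₂ (+ b) Q R 4∤b t P)
  where
  pair₁ : BézoutPair (+ 2 * m) (+ 2 * n + 1ℤ) 1ℤ
  pair₁ = proj₁ (bézoutPairs m n p q bz)
  pair₂ : BézoutPair (+ 2 * m) (+ 2 * n + 1ℤ) (+ 2)
  pair₂ = proj₂ (bézoutPairs m n p q bz)

mainTheorem6 : (a b : ℕ) → .{{NonZero a}} → .{{NonZero b}} →
    ((∃[ n₁ ] ∃[ n₂ ] (+ a ≡ n₁ * n₁ + n₂ * n₂) × gcd ∣ n₁ ∣ ∣ n₂ ∣ ≡ 1)
      ⊎ ((∃[ n₁ ] ∃[ n₂ ] (+ a ≡ n₁ * n₁ + n₂ * n₂) × (gcd ∣ n₁ ∣ ∣ n₂ ∣ ≡ 2) × (+ 4 ∣ n₁))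
          × ¬ (+ 4 ∣ + b))) →
    ∀ x → InQ² a b x → SumOfFourSquares a b x
mainTheorem6 a b (inj₁ (n₁ , n₂ , a≡ , g≡1)) x x∈ =
  InQ²⇒SumOfFourSquares x∈ (fourSquares-gcd1 n₁ n₂ a≡ g≡1 (+ b))
mainTheorem6 a b (inj₂ ((n₁ , n₂ , a≡ , g≡2 , 4∣n₁) , 4∤b)) x x∈ =
  InQ²⇒SumOfFourSquares x∈ (fourSquares-gcd2 (evenOddHalves n₁ n₂ a≡ g≡2 4∣n₁) 4∤b)
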